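{- Let $t$ be a natural number and $n=t^3$. Then there is a $k$-sorting network on $n$ inputs of depth $4$ with $k=2t^2$.
   Context: A $k$-sorting network of depth $d$ with $n$ inputs consists of arrays $A_1,\dots,A_{d+1}$ of length $n$ and, for each $i=1,\dots,d$, a layer: a partition of $\{1,\dots,n\}$ into comparators (subsets) of size at most $k$. Each comparator $S$ of layer $i$ sorts the values $\{A_i[j]: j\in S\}$ in non-decreasing order and writes them into $\{A_{i+1}[j]:j\in S\}$ in increasing order of $j$. The network is required to output a non-decreasingly sorted array $A_{d+1}$ for every input $A_1$. -}

module Defs where

open import Data.Nat using (ℕ; _≤_; _*_; _^_)
open import Data.Nat.Properties using (≤-totalOrder)
open import Data.Fin using (Fin) renaming (_≤_ to _≤ᶠ_)
open import Data.Fin.Properties using (_≟_)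
open import Data.List using (List; length; map; filter)
open import Data.List.Base using (allFin)
open import Data.List.Relation.Binary.Permutation.Propositional using (_↭_)
open import Data.List.Relation.Unary.Sorted.TotalOrder ≤-totalOrder using (Sorted)
open import Data.Vec using (Vec; []; _∷_)
open import Data.Product using (Σ; _×_)
open import Data.Vec.Relation.Unary.All using (All)

Array : ℕ → Set
Array n = Fin n → ℕ

-- A layer on n wires: a partition of the positions into comparators,
-- encoded by a labelling map; the comparators are the (nonempty) fibres.
Layer : ℕ → Set
Layer n = Fin n → Fin n

block : ∀ {n} → Layer n → Fin n → List (Fin n)
block {n} L b = filter (λ j → L j ≟ b) (allFin n)

LayerOfSize : ∀ {n} → ℕ → Layer n → Set
LayerOfSize k L = ∀ b → length (block L b) ≤ k

LayerStep : ∀ {n} → Layer n → Array n → Array n → Set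
LayerStep L A B =
  ∀ b → (map B (block L b) ↭ map A (block L b)) × Sorted (map B (block L b))

data Runs {n : ℕ} : ∀ {d} → Vec (Layer n) d → Array n → Array n → Set where
  done : ∀ {A} → Runs [] A A
  step : ∀ {d} {L} {Ls : Vec (Layer n) d} {A B C} →
         LayerStep L A B → Runs Ls B C → Runs (L ∷ Ls) A C

SortedArray : ∀ {n} → Array n → Set
SortedArray {n} A = ∀ (i j : Fin n) → i ≤ᶠ j → A i ≤ A j

IsKSortingNetwork : ∀ {n d} → ℕ → Vec (Layer n) d → Set
IsKSortingNetwork {n} k Ls =
  All (LayerOfSize k) Ls
  × (∀ (A : Array n) → Σ (Array n) (λ B → Runs Ls A B))
  × (∀ (A B : Array n) → Runs Ls A B → SortedArray B)

{-# OPTIONS --safe #-}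
-- Fix a threshold v and call the entries ≥ v ones.  Read the t³ wires as a grid of
-- T = t² rows of length t in row-major order.  The first layer sorts blocks of t
-- consecutive rows, so each row is sorted and ends with at most the first entry of
-- the next row of its block; the second layer sorts the columns.  If column c holds
-- D c ones, then D is monotone and D (t − 1) ≤ D 0 + t, since each of the t row
-- blocks contributes at most one extra one to the last column.  After the column
-- sort, column c has its ones in its last D c rows, so only the rows between
-- T − D (t − 1) and T − D 0, at most T wires, are unsettled.  The last two layers
-- sort intervals of length 2T, offset against each other by T, so one of them sorts
-- an interval containing that window, and interval layers never disturb the settled
-- zeros in front of it and ones behind it.  Being sorted with respect to every
-- threshold is being sorted.
module Submission where

open import Defs
open import Data.Nat using (ℕ; zero; suc; NonZero; _+_; _*_; _∸_; _^_; _⊓_; _/_; _%_; _≤_; _<_; _≤?_; _<?_; z≤n; s≤s; s≤s⁻¹; z<s)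
open import Data.Nat.Properties hiding (_≟_)
open import Data.Fin as Fin using (Fin; toℕ; fromℕ<)
open import Data.Fin.Properties using (_≟_; toℕ<n; toℕ-fromℕ<; fromℕ<-toℕ; toℕ-injective; toℕ-cast)
open import Data.List using (List; []; _∷_; length; map; filter; tabulate; allFin)
open import Data.List.Properties using (length-map; length-tabulate; lookup-tabulate; map-tabulate; filter-accept; filter-reject)
open import Data.List.Membership.Propositional using (_∈_)
open import Data.List.Relation.Binary.Subset.Propositional using (_⊆_)
open import Data.List.Membership.Propositional.Properties using (∈-filter⁻; ∈-filter⁺; ∈-tabulate⁻; ∈-tabulate⁺)
open import Data.List.Relation.Unary.Any using (here; there)
open import Data.List.Relation.Unary.All as All using ()
open import Data.List.Relation.Unary.AllPairs as AllPairs using (AllPairs; []; _∷_)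
open import Data.List.Relation.Unary.AllPairs.Properties using (tabulate⁺-<) renaming (filter⁺ to allPairs-filter⁺)
open import Data.List.Relation.Binary.Permutation.Propositional.Properties using (↭-length; filter-↭)
open import Data.List.Relation.Unary.Sorted.TotalOrder.Properties using (lookup-mono-≤)
open import Data.List.Sort ≤-decTotalOrder using (sort; sort-↭; sort-↗)
open import Data.List.Relation.Unary.Sorted.TotalOrder ≤-totalOrder using (Sorted)
open import Data.Nat.DivMod
open import Data.Nat.Tactic.RingSolver using (solve-∀)
open import Data.Vec using (Vec; []; _∷_; replicate)
open import Data.Vec.Relation.Unary.All as VecAll using ([]; _∷_) renaming (All to VecAll)
open import Data.Product using (Σ; ∃; _×_; _,_; proj₁; proj₂)
open import Data.Empty using (⊥; ⊥-elim)
open import Relation.Nullary using (¬_; yes; no)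
open import Function using (_∘_)
open import Relation.Binary.PropositionalEquality

nthOr0 : List ℕ → ℕ → ℕ
nthOr0 []       _       = 0
nthOr0 (x ∷ xs) zero    = x
nthOr0 (x ∷ xs) (suc i) = nthOr0 xs i

indexOf : ∀ {n} → Fin n → List (Fin n) → ℕ
indexOf j [] = 0
indexOf j (x ∷ xs) with j ≟ x
... | yes _ = 0
... | no  _ = suc (indexOf j xs)

indexOf-here : ∀ {n} (x : Fin n) xs → indexOf x (x ∷ xs) ≡ 0
indexOf-here x xs with x ≟ x
... | yes _  = refl
... | no x≢x = ⊥-elim (x≢x refl)

indexOf-there : ∀ {n} {j x : Fin n} xs → j ≢ x → indexOf j (x ∷ xs) ≡ suc (indexOf j xs)
indexOf-there {j = j} {x} xs j≢x with j ≟ x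
... | yes j≡x = ⊥-elim (j≢x j≡x)
... | no  _   = refl

map-≡-nthOr0 : ∀ {n} (ℓ : List (Fin n)) (s : List ℕ) (f : Fin n → ℕ) →
  AllPairs _≢_ ℓ → length s ≡ length ℓ →
  (∀ {j} → j ∈ ℓ → f j ≡ nthOr0 s (indexOf j ℓ)) → map f ℓ ≡ s
map-≡-nthOr0 []      []      f _          _   _  = refl
map-≡-nthOr0 (x ∷ ℓ) (y ∷ s) f (x∉ℓ ∷ ℓ!) len fℓ = cong₂ _∷_
  (trans (fℓ (here refl)) (cong (nthOr0 (y ∷ s)) (indexOf-here x ℓ)))
  (map-≡-nthOr0 ℓ s f ℓ! (suc-injective len) λ {j} j∈ℓ →
    trans (fℓ (there j∈ℓ))
          (cong (nthOr0 (y ∷ s)) (indexOf-there ℓ λ j≡x → All.lookup x∉ℓ j∈ℓ (sym j≡x))))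

block-ascending : ∀ {n} (L : Layer n) b → AllPairs Fin._<_ (block L b)
block-ascending L b = allPairs-filter⁺ (λ j → L j ≟ b) (tabulate⁺-< (λ i<j → i<j))

ascending⇒distinct : ∀ {n} {ℓ : List (Fin n)} → AllPairs Fin._<_ ℓ → AllPairs _≢_ ℓ
ascending⇒distinct = AllPairs.map (λ i<j i≡j → <-irrefl (cong toℕ i≡j) i<j)

applyLayer : ∀ {n} → Layer n → Array n → Array n
applyLayer L A j = nthOr0 (sort (map A (block L (L j)))) (indexOf j (block L (L j)))

map-applyLayer : ∀ {n} (L : Layer n) (A : Array n) b →
  map (applyLayer L A) (block L b) ≡ sort (map A (block L b))
map-applyLayer L A b = map-≡-nthOr0 (block L b) _ (applyLayer L A)
  (ascending⇒distinct (block-ascending L b))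
  (trans (↭-length (sort-↭ (map A (block L b)))) (length-map A (block L b)))
  λ j∈ → cong (λ b′ → nthOr0 (sort (map A (block L b′))) (indexOf _ (block L b′)))
              (proj₂ (∈-filter⁻ (λ j → L j ≟ b) {xs = allFin _} j∈))

applyLayer-step : ∀ {n} (L : Layer n) (A : Array n) → LayerStep L A (applyLayer L A)
applyLayer-step L A b rewrite map-applyLayer L A b = sort-↭ _ , sort-↗ _

runs-exist : ∀ {n d} (Ls : Vec (Layer n) d) (A : Array n) → ∃ λ B → Runs Ls A B
runs-exist []       A = A , done
runs-exist (L ∷ Ls) A with runs-exist Ls (applyLayer L A)
... | B , r = B , step (applyLayer-step L A) r

-- Counting entries above a threshold

ones : ℕ → (ℕ → ℕ) → ℕ → ℕ
ones v g zero = 0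
ones v g (suc m) with v ≤? g 0
... | yes _ = suc (ones v (g ∘ suc) m)
... | no  _ = ones v (g ∘ suc) m

ones≤ : ∀ v g m → ones v g m ≤ m
ones≤ v g zero = z≤n
ones≤ v g (suc m) with v ≤? g 0
... | yes _ = s≤s (ones≤ v (g ∘ suc) m)
... | no  _ = m≤n⇒m≤1+n (ones≤ v (g ∘ suc) m)

ones-mono : ∀ v {g h} m → (∀ {q} → q < m → v ≤ g q → v ≤ h q) → ones v g m ≤ ones v h m
ones-mono v zero g⇒h = z≤n
ones-mono v {g} {h} (suc m) g⇒h with v ≤? g 0 | v ≤? h 0
... | yes _  | yes _  = s≤s (ones-mono v m (g⇒h ∘ s≤s))
... | no  _  | yes _  = m≤n⇒m≤1+n (ones-mono v m (g⇒h ∘ s≤s))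
... | no  _  | no  _  = ones-mono v m (g⇒h ∘ s≤s)
... | yes g₀ | no ¬h₀ = ⊥-elim (¬h₀ (g⇒h z<s g₀))

ones-cong : ∀ v {g h} m → (∀ {q} → q < m → g q ≡ h q) → ones v g m ≡ ones v h m
ones-cong v m g≗h = ≤-antisym (ones-mono v m λ q<m → subst (v ≤_) (g≗h q<m))
                              (ones-mono v m λ q<m → subst (v ≤_) (sym (g≗h q<m)))

ones-+ : ∀ v g a b → ones v g (a + b) ≡ ones v g a + ones v (λ q → g (a + q)) b
ones-+ v g zero    b = refl
ones-+ v g (suc a) b with v ≤? g 0
... | yes _ = cong suc (ones-+ v (g ∘ suc) a b)
... | no  _ = ones-+ v (g ∘ suc) a b

ones-suc≤ : ∀ v g m → ones v (g ∘ suc) m ≤ ones v g (suc m)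
ones-suc≤ v g m with v ≤? g 0
... | yes _ = n≤1+n _
... | no  _ = ≤-refl

ones-from : ∀ v g m q → (∀ {q′} → q ≤ q′ → q′ < m → v ≤ g q′) → m ≤ q + ones v g m
ones-from v g zero    q       _    = z≤n
ones-from v g (suc m) q       ones with v ≤? g 0
ones-from v g (suc m) zero    ones | no ¬g₀ = ⊥-elim (¬g₀ (ones z≤n z<s))
ones-from v g (suc m) zero    ones | yes _  =
  s≤s (ones-from v (g ∘ suc) m zero λ _ q′<m → ones z≤n (s≤s q′<m))
ones-from v g (suc m) (suc q) ones | yes _  =
  s≤s (≤-trans (ones-from v (g ∘ suc) m q λ q≤q′ q′<m → ones (s≤s q≤q′) (s≤s q′<m))
               (+-monoʳ-≤ q (n≤1+n _)))
ones-from v g (suc m) (suc q) ones | no  _  =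
  s≤s (ones-from v (g ∘ suc) m q λ q≤q′ q′<m → ones (s≤s q≤q′) (s≤s q′<m))

ones-below : ∀ v g m q → q < m → (∀ {q′} → q′ ≤ q → ¬ v ≤ g q′) → suc q + ones v g m ≤ m
ones-below v g (suc m) q q<m zeros with v ≤? g 0
... | yes g₀ = ⊥-elim (zeros z≤n g₀)
ones-below v g (suc m) zero    _          zeros | no _ = s≤s (ones≤ v (g ∘ suc) m)
ones-below v g (suc m) (suc q) (s≤s q<m) zeros | no _ = s≤s (ones-below v (g ∘ suc) m q q<m (zeros ∘ s≤s))

MonotoneBelow : ℕ → (ℕ → ℕ) → Set
MonotoneBelow m g = ∀ {q q′} → q ≤ q′ → q′ < m → g q ≤ g q′

module _ {v m : ℕ} {g : ℕ → ℕ} (mono : MonotoneBelow m g) {q : ℕ} (q<m : q < m) where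

  one⇒ones : v ≤ g q → m ≤ q + ones v g m
  one⇒ones g₀ = ones-from v g m q λ q≤q′ q′<m → ≤-trans g₀ (mono q≤q′ q′<m)

  zero⇒ones : ¬ v ≤ g q → suc q + ones v g m ≤ m
  zero⇒ones ¬g₀ = ones-below v g m q q<m λ q′≤q g′ → ¬g₀ (≤-trans g′ (mono q′≤q q<m))

ones-shifted : ∀ v g h m → (∀ {b} → b < m → v ≤ g b → v ≤ h (suc b)) →
  ones v g (suc m) ≤ ones v h (suc m) + 1
ones-shifted v g h m g⇒h = begin
  ones v g (suc m)                        ≡⟨ cong (ones v g) (+-comm 1 m) ⟩
  ones v g (m + 1)                        ≡⟨ ones-+ v g m 1 ⟩
  ones v g m + ones v (λ q → g (m + q)) 1 ≤⟨ +-mono-≤ (ones-mono v m g⇒h) (ones≤ v _ 1) ⟩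
  ones v (h ∘ suc) m + 1                  ≤⟨ +-monoˡ-≤ 1 (ones-suc≤ v h m) ⟩
  ones v h (suc m) + 1                    ∎
  where open ≤-Reasoning

ones-blockwise : ∀ v g h t k →
  (∀ {a} → a < k → ones v (λ b → g (a * t + b)) t ≤ ones v (λ b → h (a * t + b)) t + 1) →
  ones v g (k * t) ≤ ones v h (k * t) + k
ones-blockwise v g h t zero    _        = z≤n
ones-blockwise v g h t (suc k) blockwise = begin
  ones v g (t + k * t)                                              ≡⟨ ones-+ v g t (k * t) ⟩
  ones v g t + ones v (λ q → g (t + q)) (k * t)                     ≤⟨ +-mono-≤ (blockwise z<s) rest ⟩
  (ones v h t + 1) + (ones v (λ q → h (t + q)) (k * t) + k)         ≡⟨ rearrange (ones v h t) _ k ⟩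
  (ones v h t + ones v (λ q → h (t + q)) (k * t)) + suc k           ≡⟨ cong (_+ suc k) (ones-+ v h t (k * t)) ⟨
  ones v h (t + k * t) + suc k                                      ∎
  where
  open ≤-Reasoning
  shift : ∀ a b → t + (a * t + b) ≡ suc a * t + b
  shift a b = sym (+-assoc t (a * t) b)
  rest : ones v (λ q → g (t + q)) (k * t) ≤ ones v (λ q → h (t + q)) (k * t) + k
  rest = ones-blockwise v (λ q → g (t + q)) (λ q → h (t + q)) t k λ {a} a<k →
    subst₂ _≤_ (ones-cong v t λ {b} _ → cong g (sym (shift a b)))
               (cong (_+ 1) (ones-cong v t λ {b} _ → cong h (sym (shift a b))))
      (blockwise (s≤s a<k))
  rearrange : ∀ x y k → (x + 1) + (y + k) ≡ (x + y) + suc k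
  rearrange = solve-∀

-- Positions as natural numbers; reading past the end yields the junk value 0.
_!_ : ∀ {n} → Array n → ℕ → ℕ
_!_ {n} A p with p <? n
... | yes p<n = A (fromℕ< p<n)
... | no  _   = 0

!-fromℕ< : ∀ {n} (A : Array n) {p} (p<n : p < n) → A ! p ≡ A (fromℕ< p<n)
!-fromℕ< {n} A {p} p<n with p <? n
... | yes _   = refl
... | no  p≮n = ⊥-elim (p≮n p<n)

!-toℕ : ∀ {n} (A : Array n) (j : Fin n) → A ! toℕ j ≡ A j
!-toℕ A j = trans (!-fromℕ< A (toℕ<n j)) (cong A (fromℕ<-toℕ j (toℕ<n j)))

!-offset : ∀ {n} (C : Array n) {l p} → l ≤ p → C ! p ≡ C ! (l + (p ∸ l))
!-offset C l≤p = cong (C !_) (sym (m+[n∸m]≡n l≤p))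

module _ {n : ℕ} where

  private
    ⊆-tail : ∀ {a : Fin n} {zs ws} → All.All (a Fin.<_) zs → zs ⊆ (a ∷ ws) → zs ⊆ ws
    ⊆-tail a< zs⊆ z∈ with zs⊆ z∈
    ... | here refl = ⊥-elim (<-irrefl refl (All.lookup a< z∈))
    ... | there z∈ws = z∈ws

    heads-≡ : ∀ {x y : Fin n} {xs ys} → All.All (x Fin.<_) xs → All.All (y Fin.<_) ys →
      (x ∷ xs) ⊆ (y ∷ ys) → (y ∷ ys) ⊆ (x ∷ xs) → x ≡ y
    heads-≡ x< y< xs⊆ ys⊆ with xs⊆ (here refl) | ys⊆ (here refl)
    ... | here x≡y | _        = x≡y
    ... | there _  | here y≡x = sym y≡x
    ... | there y∈ | there x∈ = ⊥-elim (<-asym (All.lookup y< y∈) (All.lookup x< x∈))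

  ascending-≡ : ∀ {xs ys : List (Fin n)} → AllPairs Fin._<_ xs → AllPairs Fin._<_ ys →
    xs ⊆ ys → ys ⊆ xs → xs ≡ ys
  ascending-≡ {[]}    {[]}    _ _ _ _ = refl
  ascending-≡ {[]}    {_ ∷ _} _ _ _ ys⊆ with ys⊆ (here refl)
  ... | ()
  ascending-≡ {_ ∷ _} {[]}    _ _ xs⊆ _ with xs⊆ (here refl)
  ... | ()
  ascending-≡ {x ∷ _} {_ ∷ _} (x< ∷ xs<) (y< ∷ ys<) xs⊆ ys⊆ with heads-≡ x< y< xs⊆ ys⊆
  ... | refl = cong (x ∷_) (ascending-≡ xs< ys< (⊆-tail x< (λ z∈ → xs⊆ (there z∈)))
                                                 (⊆-tail y< (λ z∈ → ys⊆ (there z∈))))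

length-filter-tabulate : ∀ v m (g : Fin m → ℕ) (h : ℕ → ℕ) → (∀ q → g q ≡ h (toℕ q)) →
  length (filter (v ≤?_) (tabulate g)) ≡ ones v h m
length-filter-tabulate v zero    g h g≗h = refl
length-filter-tabulate v (suc m) g h g≗h with v ≤? h 0
... | yes v≤ = trans (cong length (filter-accept (v ≤?_) (subst (v ≤_) (sym (g≗h Fin.zero)) v≤)))
                     (cong suc (length-filter-tabulate v m (g ∘ Fin.suc) (h ∘ suc) (g≗h ∘ Fin.suc)))
... | no  v≰ = trans (cong length (filter-reject (v ≤?_) (v≰ ∘ subst (v ≤_) (g≗h Fin.zero))))
                     (length-filter-tabulate v m (g ∘ Fin.suc) (h ∘ suc) (g≗h ∘ Fin.suc))

tabulate-sorted⇒monotone : ∀ {m} (g : Fin m → ℕ) → Sorted (tabulate g) →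
  ∀ {i j} → i Fin.≤ j → g i ≤ g j
tabulate-sorted⇒monotone g sorted {i} {j} i≤j =
  subst₂ _≤_ (lookup-tabulate g i) (lookup-tabulate g j)
    (lookup-mono-≤ ≤-totalOrder sorted
      (subst₂ _≤_ (sym (toℕ-cast (sym (length-tabulate g)) i)) (sym (toℕ-cast (sym (length-tabulate g)) j)) i≤j))

labelLayer : ∀ {n} (lab : ℕ → ℕ) → (∀ p → lab p ≤ p) → Layer n
labelLayer lab lab≤ j = fromℕ< (≤-<-trans (lab≤ (toℕ j)) (toℕ<n j))

record Enumerates (n : ℕ) (lab : ℕ → ℕ) (c m : ℕ) (e : ℕ → ℕ) : Set where
  field
    e<n      : ∀ {q} → q < m → e q < n
    lab-e    : ∀ {q} → q < m → lab (e q) ≡ c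
    e-mono   : ∀ {q q′} → q < q′ → q′ < m → e q < e q′
    e-onto   : ∀ {p} → p < n → lab p ≡ c → ∃ λ q → q < m × e q ≡ p

module LabelledBlock {n : ℕ} (lab : ℕ → ℕ) (lab≤ : ∀ p → lab p ≤ p)
                     {c m : ℕ} {e : ℕ → ℕ} (E : Enumerates n lab c m e) (b : Fin n) (b≡c : toℕ b ≡ c) where
  open Enumerates E

  L : Layer n
  L = labelLayer lab lab≤

  member : Fin m → Fin n
  member q = fromℕ< (e<n (toℕ<n q))

  toℕ-member : ∀ q → toℕ (member q) ≡ e (toℕ q)
  toℕ-member q = toℕ-fromℕ< (e<n (toℕ<n q))

  ∈block⇒L≡b : ∀ {j} → j ∈ block L b → L j ≡ b
  ∈block⇒L≡b = proj₂ ∘ ∈-filter⁻ (λ j → L j ≟ b) {xs = allFin n}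

  L≡b⇒lab≡c : ∀ {j} → L j ≡ b → lab (toℕ j) ≡ c
  L≡b⇒lab≡c {j} Lj≡b = trans (sym (toℕ-fromℕ< _)) (trans (cong toℕ Lj≡b) b≡c)

  lab≡c⇒L≡b : ∀ {j} → lab (toℕ j) ≡ c → L j ≡ b
  lab≡c⇒L≡b lab≡c = toℕ-injective (trans (toℕ-fromℕ< _) (trans lab≡c (sym b≡c)))

  block≡ : block L b ≡ tabulate member
  block≡ = ascending-≡ (block-ascending L b)
    (tabulate⁺-< λ {i} {j} i<j → subst₂ _<_ (sym (toℕ-member i)) (sym (toℕ-member j)) (e-mono i<j (toℕ<n j)))
    block⊆ tabulate⊆
    where
    block⊆ : block L b ⊆ tabulate member
    block⊆ {z} z∈ with e-onto (toℕ<n z) (L≡b⇒lab≡c (∈block⇒L≡b z∈))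
    ... | q , q<m , eq≡z = subst (_∈ tabulate member)
            (toℕ-injective (trans (toℕ-member _) (trans (cong e (toℕ-fromℕ< q<m)) eq≡z)))
            (∈-tabulate⁺ (fromℕ< q<m))
    tabulate⊆ : tabulate member ⊆ block L b
    tabulate⊆ {z} z∈ with ∈-tabulate⁻ z∈
    ... | q , refl = ∈-filter⁺ (λ j → L j ≟ b) (∈-tabulate⁺ {f = λ j → j} z)
                       (lab≡c⇒L≡b (trans (cong lab (toℕ-member q)) (lab-e (toℕ<n q))))

  length-block : length (block L b) ≡ m
  length-block = trans (cong length block≡) (length-tabulate member)

  member-! : ∀ (C : Array n) q → C (member q) ≡ C ! e (toℕ q)
  member-! C q = sym (!-fromℕ< C (e<n (toℕ<n q)))

  map-block : ∀ (C : Array n) → map C (block L b) ≡ tabulate (C ∘ member)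
  map-block C = trans (cong (map C) block≡) (map-tabulate member C)

  module _ {A B : Array n} (st : LayerStep L A B) where

    sorted-block : MonotoneBelow m (λ q → B ! e q)
    sorted-block {q} {q′} q≤q′ q′<m =
      subst₂ _≤_ (trans (member-! B (fromℕ< q<m)) (cong (λ i → B ! e i) (toℕ-fromℕ< q<m)))
                 (trans (member-! B (fromℕ< q′<m)) (cong (λ i → B ! e i) (toℕ-fromℕ< q′<m)))
        (tabulate-sorted⇒monotone (B ∘ member) (subst Sorted (map-block B) (proj₂ (st b)))
          (subst₂ _≤_ (sym (toℕ-fromℕ< q<m)) (sym (toℕ-fromℕ< q′<m)) q≤q′))
      where q<m = ≤-<-trans q≤q′ q′<m

    ones-block : ∀ v → ones v (λ q → B ! e q) m ≡ ones v (λ q → A ! e q) m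
    ones-block v = begin
      ones v (λ q → B ! e q) m                            ≡⟨ length-filter-tabulate v m _ _ (member-! B) ⟨
      length (filter (v ≤?_) (tabulate (B ∘ member)))      ≡⟨ cong (length ∘ filter (v ≤?_)) (map-block B) ⟨
      length (filter (v ≤?_) (map B (block L b)))         ≡⟨ ↭-length (filter-↭ (v ≤?_) (proj₁ (st b))) ⟩
      length (filter (v ≤?_) (map A (block L b)))         ≡⟨ cong (length ∘ filter (v ≤?_)) (map-block A) ⟩
      length (filter (v ≤?_) (tabulate (A ∘ member)))      ≡⟨ length-filter-tabulate v m _ _ (member-! A) ⟩
      ones v (λ q → A ! e q) m                            ∎
      where open ≡-Reasoning

    one⇒onesBefore : ∀ {v q} → q < m → v ≤ B ! e q → m ≤ q + ones v (λ q → A ! e q) m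
    one⇒onesBefore {v} q<m one = subst (λ k → m ≤ _ + k) (ones-block v) (one⇒ones sorted-block q<m one)

    zero⇒onesBefore : ∀ {v q} → q < m → ¬ v ≤ B ! e q → suc q + ones v (λ q → A ! e q) m ≤ m
    zero⇒onesBefore {v} q<m ¬one = subst (λ k → suc _ + k ≤ m) (ones-block v) (zero⇒ones sorted-block q<m ¬one)

labelLayer-size : ∀ {n} lab (lab≤ : ∀ p → lab p ≤ p) k →
  (∀ {p} → p < n → ∃ λ m → ∃ λ e → Enumerates n lab (lab p) m e × m ≤ k) →
  LayerOfSize k (labelLayer {n} lab lab≤)
labelLayer-size {n} lab lab≤ k enum b with block (labelLayer {n} lab lab≤) b in eq
... | []    = z≤n
... | j ∷ _ with enum (toℕ<n j)
...   | m , e , E , m≤k = subst (_≤ k) (trans (sym length-block) (cong length eq)) m≤k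
  where
  lab≡b : lab (toℕ j) ≡ toℕ b
  lab≡b = trans (sym (toℕ-fromℕ< _)) (cong toℕ (proj₂ (∈-filter⁻ (λ i → labelLayer lab lab≤ i ≟ b)
                                                                   {xs = allFin n} (subst (j ∈_) (sym eq) (here refl)))))
  open LabelledBlock lab lab≤ E b (sym lab≡b)

columns-enumerate : ∀ {n R t c} .{{_ : NonZero t}} → n ≡ R * t → c < t →
  Enumerates n (_% t) c R (λ q → q * t + c)
columns-enumerate {n} {R} {t} {c} n≡Rt c<t = record
  { e<n    = λ {q} q<R → subst (q * t + c <_) (sym n≡Rt)
      (<-≤-trans (subst (q * t + c <_) (+-comm (q * t) t) (+-monoʳ-< (q * t) c<t)) (*-monoˡ-≤ t q<R))
  ; lab-e  = λ {q} _ → trans (cong (_% t) (+-comm (q * t) c)) (trans ([m+kn]%n≡m%n c q t) (m<n⇒m%n≡m c<t))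
  ; e-mono = λ q<q′ _ → +-monoˡ-< c (*-monoˡ-< t q<q′)
  ; e-onto = λ {p} p<n p%t≡c → p / t , m<n*o⇒m/o<n (subst (p <_) n≡Rt p<n) ,
      trans (cong (p / t * t +_) (sym p%t≡c)) (trans (+-comm _ (p % t)) (sym (m≡m%n+[m/n]*n p t)))
  }

-- Interval layers

record Settled {n} (v : ℕ) (C : Array n) (s e : ℕ) : Set where
  field
    below : ∀ {p} → p < s → p < n → ¬ v ≤ C ! p
    above : ∀ {p} → e ≤ p → p < n → v ≤ C ! p

settled⇒sorted : ∀ {n} (C : Array n) → (∀ v → ∃ λ x → Settled v C x x) → SortedArray C
settled⇒sorted C settled i j i≤j with C i ≤? C j
... | yes Ci≤Cj = Ci≤Cj
... | no  Ci≰Cj with settled (C i)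
...   | x , record { below = below ; above = above } with toℕ i <? x
...     | yes i<x = ⊥-elim (below i<x (toℕ<n i) (≤-reflexive (sym (!-toℕ C i))))
...     | no  i≮x =
  ⊥-elim (Ci≰Cj (subst (C i ≤_) (!-toℕ C j) (above (≤-trans (≮⇒≥ i≮x) i≤j) (toℕ<n j))))

settled-beyond : ∀ {n v} {C : Array n} {s e} → n ≤ s → Settled v C s e → Settled v C n n
settled-beyond n≤s S = record
  { below = λ p<n → Settled.below S (<-≤-trans p<n n≤s)
  ; above = λ n≤p p<n → ⊥-elim (<-irrefl refl (<-≤-trans p<n n≤p))
  }

≤∸⇒+≤ : ∀ {q a} l → l ≤ a → q ≤ a ∸ l → l + q ≤ a
≤∸⇒+≤ {q} {a} l l≤a q≤a∸l = subst (_≤ a) (+-comm q l) (m≤o∸n⇒m+n≤o q l≤a q≤a∸l)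

<∸⇒+< : ∀ {q a} l → q < a ∸ l → l + q < a
<∸⇒+< {q} {a} l q<a∸l with l ≤? a
... | yes l≤a = subst (_< a) (+-comm q l) (m≤o∸n⇒m+n≤o (suc q) l≤a q<a∸l)
... | no  l≰a = ⊥-elim (n≮0 (subst (q <_) (m≤n⇒m∸n≡0 (<⇒≤ (≰⇒> l≰a))) q<a∸l))

record IntervalPartition (lab end : ℕ → ℕ) : Set where
  field
    lab≤          : ∀ p → lab p ≤ p
    <end          : ∀ p → p < end p
    same-interval : ∀ {p p′} → lab p′ ≡ lab p → lab p ≤ p′ × p′ < end p
    interval-same : ∀ {p p′} → lab p ≤ p′ → p′ < end p → lab p′ ≡ lab p

module IntervalLayer {n : ℕ} {lab end : ℕ → ℕ} (I : IntervalPartition lab end) where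
  open IntervalPartition I public

  L : Layer n
  L = labelLayer lab lab≤

  top : ℕ → ℕ
  top p = end p ⊓ n

  width : ℕ → ℕ
  width p = top p ∸ lab p

  lab<n : ∀ {p} → p < n → lab p < n
  lab<n p<n = ≤-<-trans (lab≤ _) p<n

  lab+<top : ∀ {p q} → q < width p → lab p + q < top p
  lab+<top {p} = <∸⇒+< (lab p)

  ∸lab<width : ∀ {p p′} → p′ < n → lab p ≤ p′ → p′ < end p → p′ ∸ lab p < width p
  ∸lab<width p′<n lab≤p′ p′<end = ∸-monoˡ-< (⊓-pres-m< p′<end p′<n) lab≤p′

  enumerates : ∀ {p} → p < n → Enumerates n lab (lab p) (width p) (lab p +_)
  enumerates {p} p<n = record
    { e<n    = λ q<w → <-≤-trans (lab+<top q<w) (m⊓n≤n _ n)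
    ; lab-e  = λ q<w → interval-same (m≤m+n _ _) (<-≤-trans (lab+<top q<w) (m⊓n≤m _ n))
    ; e-mono = λ q<q′ _ → +-monoʳ-< (lab p) q<q′
    ; e-onto = λ {p′} p′<n lab≡ → let lab≤p′ , p′<end = same-interval lab≡ in
        p′ ∸ lab p , ∸lab<width p′<n lab≤p′ p′<end , m+[n∸m]≡n lab≤p′
    }

  size : ∀ {k} → (∀ p → end p ∸ lab p ≤ k) → LayerOfSize k L
  size end∸lab≤k = labelLayer-size lab lab≤ _ λ {p} p<n →
    width p , lab p +_ , enumerates p<n , ≤-trans (∸-monoˡ-≤ (lab p) (m⊓n≤m _ n)) (end∸lab≤k p)

  module Step {A B : Array n} (st : LayerStep L A B) where

    module Block {p : ℕ} (p<n : p < n) =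
      LabelledBlock lab lab≤ (enumerates p<n) (fromℕ< (lab<n p<n)) (toℕ-fromℕ< _)

    onesIn : ℕ → Array n → ℕ → ℕ
    onesIn v C p = ones v (λ q → C ! (lab p + q)) (width p)

    in-own-block : ∀ {p} → p < n → p ∸ lab p < width p
    in-own-block {p} p<n = ∸lab<width p<n (lab≤ p) (<end p)

    sorted-interval : ∀ {p p′} → p ≤ p′ → p′ < n → lab p′ ≡ lab p → B ! p ≤ B ! p′
    sorted-interval {p} {p′} p≤p′ p′<n lab≡ =
      subst₂ (λ x y → B ! x ≤ B ! y) (m+[n∸m]≡n (lab≤ p)) (m+[n∸m]≡n lab≤p′)
        (Block.sorted-block (≤-<-trans p≤p′ p′<n) st (∸-monoˡ-≤ (lab p) p≤p′)
                                                     (∸lab<width p′<n lab≤p′ p′<end))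
      where
      lab≤p′ = proj₁ (same-interval lab≡)
      p′<end = proj₂ (same-interval lab≡)

    private
      counts-clash : ∀ q x {w} → suc q + x ≤ w → w ≤ q + x → ⊥
      counts-clash _ _ sq+x≤w w≤q+x = <-irrefl refl (≤-trans sq+x≤w w≤q+x)

    preserves : ∀ {v s e} → Settled v A s e → Settled v B s e
    preserves {v} {s} {e} A-settled = record { below = below ; above = above }
      where
      open Settled A-settled renaming (below to belowA; above to aboveA)
      below : ∀ {p} → p < s → p < n → ¬ v ≤ B ! p
      below {p} p<s p<n one = counts-clash (p ∸ lab p) (onesIn v A p)
        (ones-below v _ (width p) (p ∸ lab p) (in-own-block p<n) λ q′≤q →
           let lab+q′≤p = ≤∸⇒+≤ (lab p) (lab≤ p) q′≤q in
           belowA (≤-<-trans lab+q′≤p p<s) (≤-<-trans lab+q′≤p p<n))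
        (Block.one⇒onesBefore p<n st (in-own-block p<n) (subst (v ≤_) (!-offset B (lab≤ p)) one))
      above : ∀ {p} → e ≤ p → p < n → v ≤ B ! p
      above {p} e≤p p<n with v ≤? B ! p
      ... | yes one = one
      ... | no ¬one = ⊥-elim (counts-clash (p ∸ lab p) (onesIn v A p)
        (Block.zero⇒onesBefore p<n st (in-own-block p<n) (¬one ∘ subst (v ≤_) (sym (!-offset B (lab≤ p)))))
        (ones-from v _ (width p) (p ∸ lab p) λ {q′} q≤q′ q′<w →
           aboveA (≤-trans e≤p (subst (_≤ lab p + q′) (m+[n∸m]≡n (lab≤ p)) (+-monoʳ-≤ (lab p) q≤q′)))
                  (Enumerates.e<n (enumerates p<n) q′<w)))

    collapses : ∀ {v s e} → s < n → e ≤ top s → Settled v A s e → ∃ λ x → Settled v B x x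
    collapses {v} {s} {e} s<n e≤top A-settled = l + (w ∸ c) , record { below = below ; above = above }
      where
      open Settled (preserves A-settled) renaming (below to belowB; above to aboveB)
      l = lab s
      w = width s
      c = onesIn v A s
      below : ∀ {p} → p < l + (w ∸ c) → p < n → ¬ v ≤ B ! p
      below {p} p<x p<n one with p <? l
      ... | yes p<l = belowB (<-≤-trans p<l (lab≤ s)) p<n one
      ... | no  p≮l = <-irrefl refl (<-≤-trans q+c<w
              (Block.one⇒onesBefore s<n st (<-≤-trans q<w∸c (m∸n≤m w c)) (subst (v ≤_) (!-offset B l≤p) one)))
        where
        l≤p = ≮⇒≥ p≮l
        q<w∸c : p ∸ l < w ∸ c
        q<w∸c = subst (p ∸ l <_) (m+n∸m≡n l (w ∸ c)) (∸-monoˡ-< p<x l≤p)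
        q+c<w : p ∸ l + c < w
        q+c<w = subst (_< w) (+-comm c (p ∸ l)) (<∸⇒+< c q<w∸c)
      above : ∀ {p} → l + (w ∸ c) ≤ p → p < n → v ≤ B ! p
      above {p} x≤p p<n with top s ≤? p | v ≤? B ! p
      ... | yes top≤p | _      = aboveB (≤-trans e≤top top≤p) p<n
      ... | no  _     | yes one = one
      ... | no  p≮top | no ¬one = ⊥-elim (counts-clash (p ∸ l) c
              (Block.zero⇒onesBefore s<n st q<w (¬one ∘ subst (v ≤_) (sym (!-offset B l≤p))))
              w≤q+c)
        where
        l≤p = ≤-trans (m≤m+n l (w ∸ c)) x≤p
        q<w : p ∸ l < w
        q<w = ∸-monoˡ-< (≰⇒> p≮top) l≤p
        w∸c≤q : w ∸ c ≤ p ∸ l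
        w∸c≤q = subst (_≤ p ∸ l) (m+n∸m≡n l (w ∸ c)) (∸-monoˡ-≤ l x≤p)
        w≤q+c : w ≤ p ∸ l + c
        w≤q+c = ≤-trans (m≤n+m∸n w c) (subst (_≤ p ∸ l + c) (+-comm (w ∸ c) c) (+-monoˡ-≤ c w∸c≤q))

[m∸o]∸[n∸o]≤m∸n : ∀ m n o → (m ∸ o) ∸ (n ∸ o) ≤ m ∸ n
[m∸o]∸[n∸o]≤m∸n m       n       zero    = ≤-refl
[m∸o]∸[n∸o]≤m∸n m       zero    (suc o) = m∸n≤m m (suc o)
[m∸o]∸[n∸o]≤m∸n zero    (suc n) (suc o) = ≤-reflexive (0∸n≡0 (n ∸ o))
[m∸o]∸[n∸o]≤m∸n (suc m) (suc n) (suc o) = [m∸o]∸[n∸o]≤m∸n m n o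

/-unique : ∀ {x k} W .{{_ : NonZero W}} → k * W ≤ x → x < suc k * W → x / W ≡ k
/-unique {x} {k} W kW≤x x<[1+k]W = ≤-antisym
  (s≤s⁻¹ (m<n*o⇒m/o<n x<[1+k]W))
  (subst (_≤ x / W) (m*n/n≡m k W) (/-monoˡ-≤ W kW≤x))

<[1+m/n]*n : ∀ m n .{{_ : NonZero n}} → m < suc (m / n) * n
<[1+m/n]*n m n = begin-strict
  m                     ≡⟨ m≡m%n+[m/n]*n m n ⟩
  m % n + m / n * n     <⟨ +-monoˡ-< (m / n * n) (m%n<n m n) ⟩
  n + m / n * n         ∎
  where open ≤-Reasoning

-- Truncated subtraction makes the first interval [0, W − sh).
module ShiftedBlocks (W sh : ℕ) .{{_ : NonZero W}} (sh<W : sh < W) where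

  index : ℕ → ℕ
  index p = (p + sh) / W

  start end : ℕ → ℕ
  start p = index p * W ∸ sh
  end   p = suc (index p) * W ∸ sh

  index-start : ∀ p → (start p + sh) / W ≡ index p
  index-start p with index p
  ... | zero  = trans (cong (λ x → (x + sh) / W) (0∸n≡0 sh)) (m<n⇒m/n≡0 sh<W)
  ... | suc k = trans (cong (_/ W) (m∸n+n≡m (≤-trans (<⇒≤ sh<W) (m≤m+n W (k * W))))) (m*n/n≡m (suc k) W)

  start≤ : ∀ p → start p ≤ p
  start≤ p = m≤n+o⇒m∸n≤o (index p * W) sh (subst (index p * W ≤_) (+-comm p sh) (m/n*n≤m (p + sh) W))

  <end : ∀ p → p < end p
  <end p = m+n≤o⇒m≤o∸n (suc p) (<[1+m/n]*n (p + sh) W)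

  index-interval : ∀ p {p′} → start p ≤ p′ → p′ < end p → index p′ ≡ index p
  index-interval p {p′} start≤p′ p′<end = /-unique W lower upper
    where
    lower : index p * W ≤ p′ + sh
    lower = ≤-trans (m≤n+m∸n (index p * W) sh)
                    (subst (sh + start p ≤_) (+-comm sh p′) (+-monoʳ-≤ sh start≤p′))
    upper : p′ + sh < suc (index p) * W
    upper = subst (_< suc (index p) * W) (+-comm sh p′) (<∸⇒+< sh p′<end)

  partition : IntervalPartition start end
  partition = record
    { lab≤          = start≤
    ; <end          = <end
    ; same-interval = λ {p} {p′} start≡ →
        let index≡ = trans (sym (index-start p′)) (trans (cong (λ x → (x + sh) / W) start≡) (index-start p)) in
        subst (_≤ p′) start≡ (start≤ p′) , subst (λ k → p′ < suc k * W ∸ sh) index≡ (<end p′)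
    ; interval-same = λ {p} start≤p′ p′<end → cong (λ k → k * W ∸ sh) (index-interval p start≤p′ p′<end)
    }

  end∸start≤ : ∀ p → end p ∸ start p ≤ W
  end∸start≤ p = ≤-trans ([m∸o]∸[n∸o]≤m∸n (suc (index p) * W) (index p * W) sh)
                         (≤-reflexive (m+n∸n≡m W (index p * W)))

-- The network

module Network (t′ : ℕ) where
  t T W n : ℕ
  t = suc t′
  T = t * t
  W = T + T
  n = t ^ 3

  n≡T*t : n ≡ T * t
  n≡T*t = cube t
    where
    cube : ∀ t → t * (t * (t * 1)) ≡ (t * t) * t
    cube = solve-∀

  0<t : 0 < t
  0<t = z<s

  0<T : 0 < T
  0<T = z<s

  module RowBlocks = ShiftedBlocks T 0 0<T
  module Even = ShiftedBlocks W 0 z<s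
  module Odd  = ShiftedBlocks W T (m<m+n T 0<T)
  module RowLayer  = IntervalLayer {n} RowBlocks.partition
  module EvenLayer = IntervalLayer {n} Even.partition
  module OddLayer  = IntervalLayer {n} Odd.partition

  %t≤ : ∀ p → p % t ≤ p
  %t≤ p = m%n≤m p t

  columnLayer : Layer n
  columnLayer = labelLayer (_% t) %t≤

  network : Vec (Layer n) 4
  network = RowLayer.L ∷ columnLayer ∷ EvenLayer.L ∷ OddLayer.L ∷ []

  W≡2t² : W ≡ 2 * t ^ 2
  W≡2t² = twice t
    where
    twice : ∀ t → t * t + t * t ≡ 2 * (t * (t * 1))
    twice = solve-∀

  network-size : VecAll (LayerOfSize (2 * t ^ 2)) network
  network-size = RowLayer.size (λ p → ≤-trans (RowBlocks.end∸start≤ p) T≤) ∷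
                 labelLayer-size (_% t) %t≤ _ (λ {p} _ →
                   T , (λ q → q * t + p % t) , columns-enumerate n≡T*t (m%n<n p t) , T≤) ∷
                 EvenLayer.size (λ p → ≤-trans (Even.end∸start≤ p) W≤) ∷
                 OddLayer.size (λ p → ≤-trans (Odd.end∸start≤ p) W≤) ∷ []
    where
    W≤ : W ≤ 2 * t ^ 2
    W≤ = ≤-reflexive W≡2t²
    T≤ : T ≤ 2 * t ^ 2
    T≤ = ≤-trans (m≤m+n T T) W≤

  odd-interval-covers : ∀ s → Even.end s < s + T → s + T ≤ Odd.end s
  odd-interval-covers s end<s+T =
    m+n≤o⇒m≤o∸n (s + T) (subst (λ k → s + T + T ≤ suc k * W) (sym odd-index) s+T+T≤)
    where
    K = Even.index s
    s<end : s < suc K * W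
    s<end = subst (_< suc K * W) (+-identityʳ s) (<[1+m/n]*n (s + 0) W)
    s+T+T≤ : s + T + T ≤ suc (suc K) * W
    s+T+T≤ = begin
      s + T + T      ≡⟨ +-assoc s T T ⟩
      s + W          ≤⟨ +-monoˡ-≤ W (<⇒≤ s<end) ⟩
      suc K * W + W  ≡⟨ +-comm (suc K * W) W ⟩
      suc (suc K) * W ∎
      where open ≤-Reasoning
    odd-index : Odd.index s ≡ suc K
    odd-index = /-unique W (<⇒≤ end<s+T)
      (<-≤-trans (+-monoˡ-< T s<end)
                 (≤-trans (+-monoʳ-≤ (suc K * W) (m≤m+n T T)) (≤-reflexive (+-comm (suc K * W) W))))

  position<n : ∀ {q c} → q < T → c < t → q * t + c < n
  position<n q<T c<t = Enumerates.e<n (columns-enumerate {R = T} n≡T*t c<t) q<T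

  row<T : ∀ {p} → p < n → p / t < T
  row<T {p} p<n = m<n*o⇒m/o<n (subst (p <_) n≡T*t p<n)

  !-decompose : ∀ (C : Array n) p → C ! p ≡ C ! (p / t * t + p % t)
  !-decompose C p = cong (C !_) (trans (m≡m%n+[m/n]*n p t) (+-comm (p % t) _))

  /t-block : ∀ a {b} → b < t → (a * t + b) / t ≡ a
  /t-block a {b} b<t = /-unique t (m≤m+n (a * t) b)
    (subst (a * t + b <_) (+-comm (a * t) t) (+-monoʳ-< (a * t) b<t))

  row-index : ∀ q {c} → c < t → RowBlocks.index (q * t + c) ≡ q / t
  row-index q {c} c<t = /-unique T lower upper
    where
    lower : q / t * T ≤ q * t + c + 0
    lower = begin
      q / t * T          ≡⟨ *-assoc (q / t) t t ⟨
      q / t * t * t      ≤⟨ *-monoˡ-≤ t (m/n*n≤m q t) ⟩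
      q * t              ≤⟨ m≤m+n (q * t) c ⟩
      q * t + c          ≡⟨ +-identityʳ _ ⟨
      q * t + c + 0      ∎
      where open ≤-Reasoning
    upper : q * t + c + 0 < suc (q / t) * T
    upper = begin-strict
      q * t + c + 0          ≡⟨ +-identityʳ _ ⟩
      q * t + c              <⟨ +-monoʳ-< (q * t) c<t ⟩
      q * t + t              ≡⟨ +-comm (q * t) t ⟩
      suc q * t              ≤⟨ *-monoˡ-≤ t (<[1+m/n]*n q t) ⟩
      suc (q / t) * t * t    ≡⟨ *-assoc (suc (q / t)) t t ⟩
      suc (q / t) * T        ∎
      where open ≤-Reasoning

  module Analysis {A₁ A₂ A₃ A₄ A₅ : Array n}
    (s₁ : LayerStep RowLayer.L A₁ A₂) (s₂ : LayerStep columnLayer A₂ A₃)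
    (s₃ : LayerStep EvenLayer.L A₃ A₄) (s₄ : LayerStep OddLayer.L A₄ A₅) (v : ℕ) where

    row-sorted : ∀ {q c c′} → q < T → c ≤ c′ → c′ < t → A₂ ! (q * t + c) ≤ A₂ ! (q * t + c′)
    row-sorted {q} q<T c≤c′ c′<t =
      RowLayer.Step.sorted-interval s₁ (+-monoʳ-≤ (q * t) c≤c′) (position<n q<T c′<t)
      (cong (λ k → k * T ∸ 0) (trans (row-index q c′<t) (sym (row-index q (≤-<-trans c≤c′ c′<t)))))

    -- The last entry of a row and the first entry of the next row are adjacent and lie in
    -- the same row block.
    row-end≤next-row-start : ∀ {a b} → a < t → b < t′ →
      A₂ ! ((a * t + b) * t + t′) ≤ A₂ ! ((a * t + suc b) * t + 0)
    row-end≤next-row-start {a} {b} a<t b<t′ = RowLayer.Step.sorted-interval s₁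
      (≤-trans (n≤1+n _) (≤-reflexive (adjacent (a * t) b t′))) (position<n next-row<T 0<t)
      (cong (λ k → k * T ∸ 0) (trans index-next (sym index-this)))
      where
      index-this : RowBlocks.index ((a * t + b) * t + t′) ≡ a
      index-this = trans (row-index (a * t + b) ≤-refl) (/t-block a (m≤n⇒m≤1+n b<t′))
      index-next : RowBlocks.index ((a * t + suc b) * t + 0) ≡ a
      index-next = trans (row-index (a * t + suc b) 0<t) (/t-block a (s≤s b<t′))
      adjacent : ∀ x b t′ → suc ((x + b) * suc t′ + t′) ≡ (x + suc b) * suc t′ + 0
      adjacent = solve-∀
      next-row<T : a * t + suc b < T
      next-row<T = <-≤-trans (+-monoʳ-< (a * t) (s≤s b<t′))
                             (subst (_≤ T) (+-comm t (a * t)) (*-monoˡ-≤ t a<t))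

    module Column {c : ℕ} (c<t : c < t) =
      LabelledBlock (_% t) %t≤ (columns-enumerate {R = T} n≡T*t c<t)
                    (fromℕ< (position<n 0<T c<t)) (toℕ-fromℕ< _)

    -- D c is the number of ones in column c, before and after the column layer.
    D : ℕ → ℕ
    D c = ones v (λ q → A₂ ! (q * t + c)) T

    D-mono : ∀ {c c′} → c ≤ c′ → c′ < t → D c ≤ D c′
    D-mono c≤c′ c′<t = ones-mono v T λ q<T one → ≤-trans one (row-sorted q<T c≤c′ c′<t)

    D-last≤D-first+t : D t′ ≤ D 0 + t
    D-last≤D-first+t = ones-blockwise v _ _ t t λ a<t → ones-shifted v _ _ t′ λ b<t′ one →
      ≤-trans one (row-end≤next-row-start a<t b<t′)

    -- Column c of A₃ has its ones exactly in the rows from T ∸ D c on.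
    wstart wend : ℕ
    wstart = (T ∸ D t′) * t
    wend = (T ∸ D 0) * t

    A₃-settled : Settled v A₃ wstart wend
    A₃-settled = record { below = below ; above = above }
      where
      below : ∀ {p} → p < wstart → p < n → ¬ v ≤ A₃ ! p
      below {p} p<wstart p<n one = <-irrefl refl (<-≤-trans q+D<T
          (Column.one⇒onesBefore (m%n<n p t) s₂ (row<T p<n) (subst (v ≤_) (!-decompose A₃ p) one)))
        where
        q = p / t
        c = p % t
        q<T∸D : q < T ∸ D c
        q<T∸D = <-≤-trans (*-cancelʳ-< t _ _ (≤-<-trans (m/n*n≤m p t) p<wstart))
                          (∸-monoʳ-≤ T (D-mono (s≤s⁻¹ (m%n<n p t)) ≤-refl))
        q+D<T : q + D c < T
        q+D<T = subst (_< T) (+-comm (D c) q) (<∸⇒+< (D c) q<T∸D)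
      above : ∀ {p} → wend ≤ p → p < n → v ≤ A₃ ! p
      above {p} wend≤p p<n with v ≤? A₃ ! p
      ... | yes one = one
      ... | no ¬one = ⊥-elim (<-irrefl refl (<-≤-trans (s≤s T≤q+D)
            (Column.zero⇒onesBefore (m%n<n p t) s₂ (row<T p<n)
                                    (¬one ∘ subst (v ≤_) (sym (!-decompose A₃ p))))))
        where
        q = p / t
        c = p % t
        T∸D≤q : T ∸ D c ≤ q
        T∸D≤q = ≤-trans (∸-monoʳ-≤ T (D-mono z≤n (m%n<n p t)))
                        (s≤s⁻¹ (*-cancelʳ-< t _ _ (≤-<-trans wend≤p (<[1+m/n]*n p t))))
        T≤q+D : T ≤ q + D c
        T≤q+D = ≤-trans (m≤n+m∸n T (D c))
                        (≤-trans (+-monoʳ-≤ (D c) T∸D≤q) (≤-reflexive (+-comm (D c) q)))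

    wend≤wstart+T : wend ≤ wstart + T
    wend≤wstart+T = begin
      (T ∸ D 0) * t            ≤⟨ *-monoˡ-≤ t T∸D₀≤ ⟩
      (T ∸ D t′ + t) * t       ≡⟨ *-distribʳ-+ t (T ∸ D t′) t ⟩
      wstart + T               ∎
      where
      open ≤-Reasoning
      rearrange : ∀ x y z → x + y + z ≡ x + (z + y)
      rearrange = solve-∀
      T∸D₀≤ : T ∸ D 0 ≤ T ∸ D t′ + t
      T∸D₀≤ = m≤n+o⇒m∸n≤o T (D 0) (≤-trans (m≤n+m∸n T (D t′))
        (≤-trans (+-monoˡ-≤ (T ∸ D t′) D-last≤D-first+t)
                 (≤-reflexive (rearrange (D 0) t (T ∸ D t′)))))

    wend≤n : wend ≤ n
    wend≤n = subst (wend ≤_) (sym n≡T*t) (*-monoˡ-≤ t (m∸n≤m T (D 0)))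

    A₄-settled : Settled v A₄ wstart wend
    A₄-settled = EvenLayer.Step.preserves s₃ A₃-settled

    A₅-settled : ∃ λ x → Settled v A₅ x x
    A₅-settled with wstart <? n
    ... | no wstart≮n = n , settled-beyond (≮⇒≥ wstart≮n) (OddLayer.Step.preserves s₄ A₄-settled)
    ... | yes wstart<n with wend ≤? EvenLayer.top wstart
    ...   | yes wend≤top =
      let x , A₄-collapsed = EvenLayer.Step.collapses s₃ wstart<n wend≤top A₃-settled in
      x , OddLayer.Step.preserves s₄ A₄-collapsed
    ...   | no wend≰top = OddLayer.Step.collapses s₄ wstart<n wend≤top′ A₄-settled
      where
      end<wend : Even.end wstart < wend
      end<wend = ≰⇒> (λ end≥wend → wend≰top (⊓-glb end≥wend wend≤n))
      wend≤top′ : wend ≤ OddLayer.top wstart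
      wend≤top′ = ⊓-glb (≤-trans wend≤wstart+T
                                 (odd-interval-covers wstart (<-≤-trans end<wend wend≤wstart+T)))
                        wend≤n

  sorts : ∀ A B → Runs network A B → SortedArray B
  sorts A B (step s₁ (step s₂ (step s₃ (step s₄ done)))) =
    settled⇒sorted B (Analysis.A₅-settled s₁ s₂ s₃ s₄)

empty-network : ∀ {d} k (Ls : Vec (Layer 0) d) → IsKSortingNetwork k Ls
empty-network k Ls = VecAll.universal (λ _ ()) Ls , runs-exist Ls , λ _ _ _ ()

mainTheorem8 : ∀ (t : ℕ) →
    Σ (Vec (Layer (t ^ 3)) 4) (λ net → IsKSortingNetwork (2 * t ^ 2) net)
mainTheorem8 zero     = replicate 4 (λ ()) , empty-network _ _
mainTheorem8 (suc t′) = network , network-size , runs-exist network , sorts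
  where open Network t′
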